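{- Let $n$ and $d$ be positive integers and let $A,B\subset\mathbb{Z}^d$ with $A\cap B=\emptyset$ and $|A|=|B|=n$. Then there exist $p\in A$ and $q\in B$ such that $\max_{1\le i\le d}|p_i-q_i|\ \ge\ \left\lceil \tfrac{1}{2}\left\lceil \sqrt[d]{2n}\right\rceil\right\rceil-1$. -}

module Defs where

open import Data.Nat using (ℕ; zero; suc; _^_; _≤ᵇ_; _⊔_; _/_)
open import Data.Integer using (ℤ; ∣_∣; _-_)
open import Data.Vec using (Vec; foldr′; zipWith)
open import Data.Bool using (if_then_else_)

chebyshev : ∀ {d} → Vec ℤ d → Vec ℤ d → ℕ
chebyshev p q = foldr′ _⊔_ 0 (zipWith (λ a b → ∣ a - b ∣) p q)

ceilRootFrom : ℕ → ℕ → ℕ → ℕ → ℕ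
ceilRootFrom d m k zero = k
ceilRootFrom d m k (suc fuel) = if m ≤ᵇ k ^ d then k else ceilRootFrom d m (suc k) fuel

-- ⌈ m^(1/d) ⌉ : the least k with m ≤ k^d (correct for d ≥ 1, as then k ≤ m).
ceilRoot : ℕ → ℕ → ℕ
ceilRoot d m = ceilRootFrom d m 0 m

ceilHalf : ℕ → ℕ
ceilHalf r = suc r / 2

-- Let D be the largest distance between a point of A and a point of B. Going
-- through a point of the other set, any two of the 2n distinct points of A ∪ B
-- are at distance at most 2D, so they fit into a box with 2D + 1 integers per
-- side; hence 2n ≤ (2D + 1)^d, i.e. ⌈(2n)^(1/d)⌉ ≤ 2D + 1, which rearranges to
-- the claimed bound on D.
module Submission where

open import Defs
open import Data.Nat using (ℕ; zero; suc; _+_; _*_; _∸_; _^_; _/_; NonZero)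
open import Data.Nat using (_≤_; _<_; _≥_; _≤ᵇ_; z≤n; s≤s)
import Data.Nat.Properties as ℕₚ
open import Data.Nat.DivMod using (/-mono-≤; m*n/n≡m)
open import Data.Integer using (ℤ; +_; ∣_∣; _-_) renaming (_≤_ to _≤ᶻ_)
import Data.Integer.Properties as ℤₚ
open import Algebra.Properties.AbelianGroup ℤₚ.+-0-abelianGroup using (∙-cancelʳ)
open import Data.Vec using (Vec; []; _∷_; lookup; tabulate)
open import Data.Vec.Properties using (tabulate∘lookup; tabulate-cong; lookup∘tabulate)
open import Data.Fin using (Fin; zero; suc; toℕ; fromℕ<; splitAt; join; funToFin; finToFun)
import Data.Fin.Properties as Fin
open import Data.Product using (∃; ∃₂; _,_; proj₁; proj₂)
open import Data.Sum using (inj₁; inj₂; [_,_]′)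
open import Data.Bool using (true; false; T)
open import Data.Empty using (⊥-elim)
open import Function using (_∘_)
open import Function.Definitions using (Injective)
open import Relation.Binary.Bundles using (TotalPreorder)
import Relation.Binary.Construct.Flip.EqAndOrd as Flip
open import Relation.Binary.PropositionalEquality
  using (_≡_; _≢_; refl; sym; trans; cong; subst; _≗_; module ≡-Reasoning)

module _ {c ℓ₁ ℓ₂} (O : TotalPreorder c ℓ₁ ℓ₂) where
  open TotalPreorder O using (Carrier; _≲_; total)
    renaming (refl to ≲-refl; trans to ≲-trans)

  argmax : ∀ {n} (f : Fin (suc n) → Carrier) → ∃ λ k → ∀ i → f i ≲ f k
  argmax {zero} f = zero , λ { zero → ≲-refl }
  argmax {suc n} f with argmax (f ∘ suc)
  ... | k , f≲fk with total (f zero) (f (suc k))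
  ...   | inj₁ f₀≲fk = suc k , λ { zero → f₀≲fk ; (suc i) → f≲fk i }
  ...   | inj₂ fk≲f₀ =
    zero , λ { zero → ≲-refl ; (suc i) → ≲-trans (f≲fk i) fk≲f₀ }

  argmax₂ : ∀ {m n} (f : Fin (suc m) → Fin (suc n) → Carrier) →
            ∃₂ λ k l → ∀ i j → f i j ≲ f k l
  argmax₂ {m} {n} f = k , l k , λ i j → ≲-trans (l-max i j) (k-max i)
    where
    l : Fin (suc m) → Fin (suc n)
    l i = proj₁ (argmax (f i))
    l-max : ∀ i j → f i j ≲ f i (l i)
    l-max i = proj₂ (argmax (f i))
    k : Fin (suc m)
    k = proj₁ (argmax (λ i → f i (l i)))
    k-max : ∀ i → f i (l i) ≲ f k (l k)
    k-max = proj₂ (argmax (λ i → f i (l i)))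

argmin : ∀ {n} (f : Fin (suc n) → ℤ) → ∃ λ k → ∀ i → f k ≤ᶻ f i
argmin = argmax (Flip.totalPreorder ℤₚ.≤-totalPreorder)

lookup-injective : ∀ {a} {A : Set a} {d} {xs ys : Vec A d} →
                   lookup xs ≗ lookup ys → xs ≡ ys
lookup-injective {xs = xs} {ys} eq = begin
  xs                   ≡⟨ tabulate∘lookup xs ⟨
  tabulate (lookup xs) ≡⟨ tabulate-cong eq ⟩
  tabulate (lookup ys) ≡⟨ tabulate∘lookup ys ⟩
  ys                   ∎
  where open ≡-Reasoning

lookup≤chebyshev : ∀ {d} (p q : Vec ℤ d) k →
                   ∣ lookup p k - lookup q k ∣ ≤ chebyshev p q
lookup≤chebyshev (x ∷ p) (y ∷ q) zero    = ℕₚ.m≤m⊔n _ _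
lookup≤chebyshev (x ∷ p) (y ∷ q) (suc k) =
  ℕₚ.≤-trans (lookup≤chebyshev p q k) (ℕₚ.m≤n⊔m _ _)

chebyshev-lub : ∀ {d D} (p q : Vec ℤ d) →
                (∀ k → ∣ lookup p k - lookup q k ∣ ≤ D) → chebyshev p q ≤ D
chebyshev-lub [] [] _ = z≤n
chebyshev-lub (x ∷ p) (y ∷ q) h = ℕₚ.⊔-lub (h zero) (chebyshev-lub p q (h ∘ suc))

chebyshev-sym : ∀ {d} (p q : Vec ℤ d) → chebyshev p q ≤ chebyshev q p
chebyshev-sym p q = chebyshev-lub p q λ k →
  subst (_≤ chebyshev q p) (ℤₚ.∣i-j∣≡∣j-i∣ (lookup q k) (lookup p k))
        (lookup≤chebyshev q p k)

∣i-k∣≤∣i-j∣+∣j-k∣ : ∀ i j k → ∣ i - k ∣ ≤ ∣ i - j ∣ + ∣ j - k ∣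
∣i-k∣≤∣i-j∣+∣j-k∣ i j k = subst (λ w → ∣ w ∣ ≤ ∣ i - j ∣ + ∣ j - k ∣)
  (ℤₚ.+-minus-telescope i j k) (ℤₚ.∣i+j∣≤∣i∣+∣j∣ (i - j) (j - k))

chebyshev-triangle : ∀ {d} (p q r : Vec ℤ d) →
                     chebyshev p r ≤ chebyshev p q + chebyshev q r
chebyshev-triangle p q r = chebyshev-lub p r λ k →
  ℕₚ.≤-trans (∣i-k∣≤∣i-j∣+∣j-k∣ (lookup p k) (lookup q k) (lookup r k))
             (ℕₚ.+-mono-≤ (lookup≤chebyshev p q k) (lookup≤chebyshev q r k))

InBox : ∀ {d} → ℕ → Vec ℤ d → Vec ℤ d → Set
InBox b l x = ∀ k → ∃ λ (o : Fin b) → lookup x k - lookup l k ≡ + toℕ o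

inBox-injective⇒≤ : ∀ {d m b} (l : Vec ℤ d) (P : Fin m → Vec ℤ d) →
                    Injective _≡_ _≡_ P → (∀ a → InBox b l (P a)) → m ≤ b ^ d
inBox-injective⇒≤ {d} {m} {b} l P P-inj box = Fin.injective⇒≤ code-injective
  where
  offset : Fin m → Fin d → Fin b
  offset a k = proj₁ (box a k)

  code-injective : Injective _≡_ _≡_ (funToFin ∘ offset)
  code-injective {a} {a′} e =
    P-inj (lookup-injective λ k → ∙-cancelʳ _ _ _ (begin
    lookup (P a) k - lookup l k    ≡⟨ proj₂ (box a k) ⟩
    + toℕ (offset a k)             ≡⟨ cong (+_ ∘ toℕ) (offset-eq k) ⟩
    + toℕ (offset a′ k)            ≡⟨ proj₂ (box a′ k) ⟨
    lookup (P a′) k - lookup l k   ∎))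
    where
    open ≡-Reasoning
    offset-eq : offset a ≗ offset a′
    offset-eq k = begin
      offset a k                          ≡⟨ Fin.finToFun-funToFin (offset a) k ⟨
      finToFun (funToFin (offset a)) k    ≡⟨ cong (λ c → finToFun c k) e ⟩
      finToFun (funToFin (offset a′)) k   ≡⟨ Fin.finToFun-funToFin (offset a′) k ⟩
      offset a′ k                         ∎

offset-inRange : ∀ {b l x} → l ≤ᶻ x → ∣ x - l ∣ < b →
                 ∃ λ (o : Fin b) → x - l ≡ + toℕ o
offset-inRange {l = l} {x} l≤x bound = fromℕ< bound , (begin
  x - l                ≡⟨ ℤₚ.0≤i⇒+∣i∣≡i (ℤₚ.i≤j⇒0≤j-i l≤x) ⟨
  + ∣ x - l ∣          ≡⟨ cong +_ (Fin.toℕ-fromℕ< bound) ⟨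
  + toℕ (fromℕ< bound) ∎)
  where open ≡-Reasoning

-- The box is spanned from the coordinatewise minimum of the points.
diameter-injective⇒≤ : ∀ {d m W} (P : Fin m → Vec ℤ d) → Injective _≡_ _≡_ P →
                       (∀ a a′ → chebyshev (P a) (P a′) ≤ W) → m ≤ suc W ^ d
diameter-injective⇒≤ {m = zero} P P-inj diam = z≤n
diameter-injective⇒≤ {d} {suc m} {W} P P-inj diam = inBox-injective⇒≤ l P P-inj box
  where
  lowest : Fin d → Fin (suc m)
  lowest k = proj₁ (argmin (λ a → lookup (P a) k))
  l : Vec ℤ d
  l = tabulate (λ k → lookup (P (lowest k)) k)
  box : ∀ a → InBox (suc W) l (P a)
  box a k rewrite lookup∘tabulate (λ k → lookup (P (lowest k)) k) k =
    offset-inRange (proj₂ (argmin (λ a → lookup (P a) k)) a)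
      (s≤s (ℕₚ.≤-trans (lookup≤chebyshev (P a) (P (lowest k)) k) (diam a (lowest k))))

[,]-injective : ∀ {a b c} {A : Set a} {B : Set b} {C : Set c} {f : A → C} {g : B → C} →
                Injective _≡_ _≡_ f → Injective _≡_ _≡_ g → (∀ x y → f x ≢ g y) →
                Injective _≡_ _≡_ [ f , g ]′
[,]-injective f-inj g-inj disj {inj₁ x} {inj₁ y} e = cong inj₁ (f-inj e)
[,]-injective f-inj g-inj disj {inj₁ x} {inj₂ y} e = ⊥-elim (disj x y e)
[,]-injective f-inj g-inj disj {inj₂ x} {inj₁ y} e = ⊥-elim (disj y x (sym e))
[,]-injective f-inj g-inj disj {inj₂ x} {inj₂ y} e = cong inj₂ (g-inj e)

splitAt-injective : ∀ m {n} → Injective _≡_ _≡_ (splitAt m {n})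
splitAt-injective m {n} {i} {j} e = begin
  i                        ≡⟨ Fin.join-splitAt m n i ⟨
  join m n (splitAt m i)   ≡⟨ cong (join m n) e ⟩
  join m n (splitAt m j)   ≡⟨ Fin.join-splitAt m n j ⟩
  j                        ∎
  where open ≡-Reasoning

union-diameter : ∀ {d n D} (A B : Fin (suc n) → Vec ℤ d) →
                 (∀ i j → chebyshev (A i) (B j) ≤ D) →
                 ∀ u v → chebyshev ([ A , B ]′ u) ([ A , B ]′ v) ≤ D + D
union-diameter {D = D} A B AB = λ where
    (inj₁ i) (inj₁ i′) → ℕₚ.≤-trans (chebyshev-triangle (A i) (B zero) (A i′))
                                    (ℕₚ.+-mono-≤ (AB i zero) (BA zero i′))
    (inj₁ i) (inj₂ j)  → ℕₚ.≤-trans (AB i j) D≤D+D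
    (inj₂ j) (inj₁ i)  → ℕₚ.≤-trans (BA j i) D≤D+D
    (inj₂ j) (inj₂ j′) → ℕₚ.≤-trans (chebyshev-triangle (B j) (A zero) (B j′))
                                    (ℕₚ.+-mono-≤ (BA j zero) (AB zero j′))
  where
  BA : ∀ j i → chebyshev (B j) (A i) ≤ D
  BA j i = ℕₚ.≤-trans (chebyshev-sym (B j) (A i)) (AB i j)
  D≤D+D : D ≤ D + D
  D≤D+D = ℕₚ.m≤m+n D D

ceilRootFrom-≤ : ∀ d m k fuel {K} → k ≤ K → m ≤ K ^ d → ceilRootFrom d m k fuel ≤ K
ceilRootFrom-≤ d m k zero k≤K _ = k≤K
ceilRootFrom-≤ d m k (suc fuel) {K} k≤K m≤K^d with m ≤ᵇ k ^ d in eq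
... | true = k≤K
... | false with ℕₚ.m≤n⇒m<n∨m≡n k≤K
...   | inj₁ k<K = ceilRootFrom-≤ d m (suc k) fuel k<K m≤K^d
...   | inj₂ refl = ⊥-elim (subst T eq (ℕₚ.≤⇒≤ᵇ m≤K^d))

≤^⇒ceilRoot≤ : ∀ d m {K} → m ≤ K ^ d → ceilRoot d m ≤ K
≤^⇒ceilRoot≤ d m = ceilRootFrom-≤ d m 0 m z≤n

≤1+2D⇒ceilHalf∸1≤D : ∀ {r} D → r ≤ suc (D + D) → ceilHalf r ∸ 1 ≤ D
≤1+2D⇒ceilHalf∸1≤D {r} D r≤ = ℕₚ.∸-monoˡ-≤ 1 (begin
  suc r / 2               ≤⟨ /-mono-≤ {o = 2} {p = 2} (s≤s r≤) ℕₚ.≤-refl ⟩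
  suc (suc (D + D)) / 2   ≡⟨ cong (_/ 2) 2+2D≡[1+D]*2 ⟩
  suc D * 2 / 2           ≡⟨ m*n/n≡m (suc D) 2 ⟩
  suc D                   ∎)
  where
  open ℕₚ.≤-Reasoning
  2+2D≡[1+D]*2 : suc (suc (D + D)) ≡ suc D * 2
  2+2D≡[1+D]*2 = cong (λ k → suc (suc k)) (begin-equality
    D + D      ≡⟨ cong (λ k → D + k) (ℕₚ.*-identityʳ D) ⟨
    D + D * 1  ≡⟨ ℕₚ.*-suc D 1 ⟨
    D * 2      ∎)

lemma4 : (n d : ℕ) → .{{NonZero n}} → .{{NonZero d}} →
         (A B : Fin n → Vec ℤ d) →
         Injective _≡_ _≡_ A → Injective _≡_ _≡_ B →
         (∀ i j → A i ≢ B j) →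
         ∃₂ λ i j → chebyshev (A i) (B j) ≥ ceilHalf (ceilRoot d (2 * n)) ∸ 1
lemma4 (suc n) d A B A-inj B-inj disjoint
  with i , j , farthest ← argmax₂ ℕₚ.≤-totalPreorder (λ i j → chebyshev (A i) (B j))
  = i , j , ≤1+2D⇒ceilHalf∸1≤D D (≤^⇒ceilRoot≤ d (2 * suc n) count)
  where
  D : ℕ
  D = chebyshev (A i) (B j)
  P : Fin (suc n + suc n) → Vec ℤ d
  P = [ A , B ]′ ∘ splitAt (suc n)
  P-inj : Injective _≡_ _≡_ P
  P-inj = splitAt-injective (suc n) ∘ [,]-injective A-inj B-inj disjoint
  P-diameter : ∀ a a′ → chebyshev (P a) (P a′) ≤ D + D
  P-diameter a a′ =
    union-diameter A B farthest (splitAt (suc n) a) (splitAt (suc n) a′)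
  count : 2 * suc n ≤ suc (D + D) ^ d
  count = subst (_≤ suc (D + D) ^ d)
                (cong (λ k → suc n + k) (sym (ℕₚ.+-identityʳ (suc n))))
                (diameter-injective⇒≤ P P-inj P-diameter)
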